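{- Let $k\ge1$ and let $\sigma$ be a fixed permutation of $\{1,\dots,k\}$. The probability that an involution of $\{1,\dots,n\}$ chosen uniformly at random contains $\sigma$ as a subsequence is $1/k!+o(1)$ as $n\to\infty$.
   Context: An involution $\phi$ of $\{1,\dots,n\}$ (with $n\ge k$) contains $\sigma$ as a subsequence if, in the one-line notation $\phi(1)\phi(2)\cdots\phi(n)$, the letters $1,2,\dots,k$ appear in the order $\sigma(1),\sigma(2),\dots,\sigma(k)$ (left to right). -}

module Defs where

open import Data.Bool using (Bool; true; false; _∧_; if_then_else_; not; _∨_)
open import Data.Nat using (ℕ; zero; suc)
open import Data.Fin using (Fin; toℕ)
import Data.Fin as F
import Data.Nat as N
open import Data.Vec using (Vec; []; _∷_; lookup)
open import Data.List using (List; []; _∷_; allFin; concatMap; map; length; filter)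
open import Data.Fin.Permutation using (Permutation′; _⟨$⟩ʳ_)
open import Relation.Nullary.Decidable using (⌊_⌋)
open import Data.Bool.ListAction using (and)

allL : {A : Set} → (A → Bool) → List A → Bool
allL p xs = and (map p xs)

allWords : (n m : ℕ) → List (Vec (Fin n) m)
allWords n zero = [] ∷ []
allWords n (suc m) = concatMap (λ a → map (a ∷_) (allWords n m)) (allFin n)

-- φ (given in one-line notation φ(1)…φ(n), 0-indexed) is an involution: φ ∘ φ = id.
-- (This forces φ to be a permutation.)
isInvolution : {n : ℕ} → Vec (Fin n) n → Bool
isInvolution {n} φ = allL (λ i → ⌊ lookup φ (lookup φ i) F.≟ i ⌋) (allFin n)

involutions : (n : ℕ) → List (Vec (Fin n) n)
involutions n = filter (λ φ → isInvolution φ Data.Bool.≟ true) (allWords n n)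
  where import Data.Bool

-- φ contains σ as a subsequence: the letters 1,…,k occur in φ(1)…φ(n) in the
-- order σ(1),…,σ(k) from left to right, i.e. for i < j in {1,…,k}, any position p
-- holding the letter σ(i) lies strictly left of any position q holding σ(j).
-- (Letters are compared via toℕ, so the letter σ(i) ∈ Fin k is the letter
-- toℕ (σ i) of Fin n.)
containsSubseq : {n k : ℕ} → Permutation′ k → Vec (Fin n) n → Bool
containsSubseq {n} {k} σ φ =
  allL (λ i → allL (λ j → allL (λ p → allL (λ q →
      not (⌊ i F.<? j ⌋
           ∧ ⌊ toℕ (lookup φ p) N.≟ toℕ (σ ⟨$⟩ʳ i) ⌋
           ∧ ⌊ toℕ (lookup φ q) N.≟ toℕ (σ ⟨$⟩ʳ j) ⌋)
      ∨ ⌊ p F.<? q ⌋)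
    (allFin n)) (allFin n)) (allFin k)) (allFin k)

numInvolutions : ℕ → ℕ
numInvolutions n = length (involutions n)

numContaining : {k : ℕ} → Permutation′ k → ℕ → ℕ
numContaining σ n = length (filter (λ φ → containsSubseq σ φ Data.Bool.≟ true) (involutions n))
  where import Data.Bool

{-# OPTIONS --safe #-}

-- Call an involution φ of {1,…,n} corner-free if it sends each of the letters 1,…,k to a letter
-- larger than k.  Since φ is its own inverse, the letter x stands at position φ(x), so φ contains σ
-- exactly when φ(σ(1)) < ⋯ < φ(σ(k)).  Conjugating by a transposition of two of the letters 1,…,k
-- maps corner-free involutions to corner-free involutions and exchanges the positions of those two
-- letters, so all k! relative orders of the positions of 1,…,k are equally frequent among the
-- corner-free involutions, and exactly a 1/k! fraction of them contain σ.
--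
-- The other involutions are rare.  For u ≠ v the number of involutions with φ(u) = v does not
-- depend on v ≠ u, so it is at most a 1/(n−1) fraction of all involutions.  The number with
-- φ(u) = u is the average number of fixed points divided by n, and the identity
-- F² = F + #(ordered pairs of distinct fixed points) together with the previous bound shows that
-- the mean of F is O(√n).  Hence a non-corner-free involution occurs with probability O(k²/√n).

module Submission where

open import Data.Bool using (Bool; true; false; T; _∧_; _∨_; not)
import Data.Bool as Bool
open import Data.Bool.ListAction using (all; and)
open import Data.Bool.Properties using (T-∧; T-≡; ∧-assoc; ∧-zeroʳ; ∧-identityʳ)
open import Data.Empty using (⊥-elim)
open import Data.Fin as Fin using (Fin; toℕ)
open import Data.Fin.Permutation using (Permutation′; _⟨$⟩ʳ_; _⟨$⟩ˡ_; inverseˡ)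
open import Data.Fin.Permutation.Components using (transpose)
import Data.Fin.Properties as Fin
open import Data.Fin.Properties using (¬∀⟶∃¬)
open import Data.Integer using (+_; _-_; ∣_∣)
import Data.Integer.Properties as ℤ
open import Data.List using (List; []; _∷_; _++_; map; concatMap; length; filter; tabulate; allFin; insertAt)
import Data.List.Properties as List
open import Data.List.Membership.Propositional.Properties using (∈-allFin; ∈-++⁺ʳ)
open import Data.List.Relation.Unary.All as All using (All; []; _∷_)
open import Data.List.Relation.Unary.All.Properties using (all⁺; all⁻; tabulate⁺; tabulate⁻; ++⁻)
open import Data.List.Relation.Unary.AllPairs using ([]; _∷_)
open import Data.List.Relation.Unary.Any using (here)
open import Data.List.Relation.Unary.Unique.Propositional using (Unique)
import Data.List.Relation.Unary.Unique.Propositional.Properties as Unique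
open import Data.Nat using (ℕ; zero; suc; _+_; _*_; _≤_; _<_; z≤n; s≤s; z<s; _!; >-nonZero)
open import Data.Nat.Properties
open import Algebra.Properties.CommutativeSemigroup +-commutativeSemigroup
  using () renaming (interchange to +-interchange)
open import Data.Nat.Tactic.RingSolver using (solve-∀)
open import Data.Product using (_×_; _,_; proj₁; proj₂; ∃)
open import Data.Unit using (tt)
open import Data.Vec using (Vec; []; _∷_; lookup)
import Data.Vec as Vec
open import Data.Vec.Properties using (≡-dec)
import Data.Vec.Properties as Vec
open import Function using (_∘_; _⇔_; mk⇔; Equivalence)
open import Relation.Binary.Definitions using (DecidableEquality; tri<; tri≈; tri>)
open import Relation.Binary.PropositionalEquality
open import Relation.Nullary using (Dec; does; yes; no)
open import Relation.Nullary.Decidable using (⌊_⌋; dec-true; dec-false; toWitness; fromWitness)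

open import Defs

𝟙 : Bool → ℕ
𝟙 false = 0
𝟙 true  = 1

𝟙≤1 : ∀ b → 𝟙 b ≤ 1
𝟙≤1 false = z≤n
𝟙≤1 true  = s≤s z≤n

𝟙-∧ : ∀ a b → 𝟙 (a ∧ b) ≡ 𝟙 a * 𝟙 b
𝟙-∧ false b = refl
𝟙-∧ true  b = sym (+-identityʳ (𝟙 b))

T-injective : ∀ {a b} → (T a ⇔ T b) → a ≡ b
T-injective {false} {false} _ = refl
T-injective {true}  {true}  _ = refl
T-injective {false} {true}  a⇔b = ⊥-elim (Equivalence.from a⇔b tt)
T-injective {true}  {false} a⇔b = ⊥-elim (Equivalence.to a⇔b tt)

T-⌊⌋ : ∀ {P : Set} (d : Dec P) → T ⌊ d ⌋ ⇔ P
T-⌊⌋ d = mk⇔ (toWitness {a? = d}) fromWitness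

T-⇒ : ∀ a b → T (not a ∨ b) ⇔ (T a → T b)
T-⇒ false b = mk⇔ (λ _ ()) (λ _ → tt)
T-⇒ true  b = mk⇔ (λ t _ → t) (λ a⇒b → a⇒b tt)

m*n+n≤m*m+n*n : ∀ m n → m * n + n ≤ m * m + n * n
m*n+n≤m*m+n*n m n with n ≤? m
... | yes n≤m = +-mono-≤ (*-monoʳ-≤ m n≤m) (n≤n*n n)
  where
  n≤n*n : ∀ n → n ≤ n * n
  n≤n*n zero    = z≤n
  n≤n*n (suc n) = m≤m*n (suc n) (suc n)
... | no  n≰m = begin
  m * n + n  ≡⟨ +-comm (m * n) n ⟩
  suc m * n  ≤⟨ *-monoˡ-≤ n (≰⇒> n≰m) ⟩
  n * n      ≤⟨ m≤n+m (n * n) (m * m) ⟩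
  m * m + n * n ∎
  where open ≤-Reasoning

relative-error : ∀ {D B I K m} → 1 ≤ I → 1 ≤ K → D ≤ B * K → 2 * suc m * B ≤ I → D * suc m < I * K
relative-error {D} {B} {I} {K} {m} 1≤I 1≤K D≤BK 2[1+m]B≤I = begin-strict
  D * suc m        ≤⟨ *-monoˡ-≤ (suc m) D≤BK ⟩
  B * K * suc m    ≡⟨ *-comm-middle B K (suc m) ⟩
  B * suc m * K    <⟨ *-monoˡ-< K {{>-nonZero 1≤K}} B[1+m]<I ⟩
  I * K            ∎
  where
  open ≤-Reasoning
  *-comm-middle : ∀ a b c → a * b * c ≡ a * c * b
  *-comm-middle = solve-∀
  half<I : ∀ y → 2 * y ≤ I → y < I
  half<I zero    _     = 1≤I
  half<I (suc y) 2y≤I = <-≤-trans (m<m+n (suc y) z<s) 2y≤I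
  B[1+m]<I : B * suc m < I
  B[1+m]<I = half<I (B * suc m) (subst (_≤ I) (regroup m B) 2[1+m]B≤I)
    where
    regroup : ∀ m B → 2 * suc m * B ≡ 2 * (B * suc m)
    regroup = solve-∀

distance-≤ : ∀ {m n d} → m ≤ n + d → n ≤ m + d → ∣ + m - + n ∣ ≤ d
distance-≤ {m} {n} {d} m≤n+d n≤m+d rewrite ℤ.m-n≡m⊖n m n with m ≤? n
... | yes m≤n = subst (_≤ d) (sym (ℤ.∣⊖∣-≤ m≤n))
                      (≤-trans (∸-monoˡ-≤ m n≤m+d) (≤-reflexive (m+n∸m≡n m d)))
... | no  m≰n = subst (_≤ d) (sym (trans (ℤ.∣m⊖n∣≡∣n⊖m∣ m n) (ℤ.∣⊖∣-< (≰⇒> m≰n))))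
                      (≤-trans (∸-monoˡ-≤ n m≤n+d) (≤-reflexive (m+n∸m≡n n d)))

-- Finite sums

module _ {A : Set} where

  ∑ : List A → (A → ℕ) → ℕ
  ∑ []       f = 0
  ∑ (x ∷ xs) f = f x + ∑ xs f

  infix 5 ∑
  syntax ∑ xs (λ x → e) = ∑[ x ← xs ] e

  ∑-cong : ∀ xs {f g : A → ℕ} → (∀ x → f x ≡ g x) → ∑ xs f ≡ ∑ xs g
  ∑-cong []       f≗g = refl
  ∑-cong (x ∷ xs) f≗g = cong₂ _+_ (f≗g x) (∑-cong xs f≗g)

  ∑-mono-≤ : ∀ xs {f g : A → ℕ} → (∀ x → f x ≤ g x) → ∑ xs f ≤ ∑ xs g
  ∑-mono-≤ []       f≤g = z≤n
  ∑-mono-≤ (x ∷ xs) f≤g = +-mono-≤ (f≤g x) (∑-mono-≤ xs f≤g)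

  ∑-distrib-+ : ∀ xs (f g : A → ℕ) → ∑[ x ← xs ] (f x + g x) ≡ ∑ xs f + ∑ xs g
  ∑-distrib-+ []       f g = refl
  ∑-distrib-+ (x ∷ xs) f g =
    trans (cong (_+_ (f x + g x)) (∑-distrib-+ xs f g)) (+-interchange (f x) (g x) (∑ xs f) (∑ xs g))

  ∑-*ˡ : ∀ xs c (f : A → ℕ) → ∑[ x ← xs ] (c * f x) ≡ c * ∑ xs f
  ∑-*ˡ []       c f = sym (*-zeroʳ c)
  ∑-*ˡ (x ∷ xs) c f = trans (cong (_+_ (c * f x)) (∑-*ˡ xs c f)) (sym (*-distribˡ-+ c (f x) (∑ xs f)))

  ∑-*ʳ : ∀ xs c (f : A → ℕ) → ∑[ x ← xs ] (f x * c) ≡ ∑ xs f * c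
  ∑-*ʳ xs c f = trans (∑-cong xs (λ x → *-comm (f x) c)) (trans (∑-*ˡ xs c f) (*-comm c (∑ xs f)))

  ∑-const : ∀ xs c → ∑[ x ← xs ] c ≡ length xs * c
  ∑-const []       c = refl
  ∑-const (x ∷ xs) c = cong (_+_ c) (∑-const xs c)

  ∑-zero : ∀ xs → ∑[ x ← xs ] 0 ≡ 0
  ∑-zero xs = trans (∑-const xs 0) (*-zeroʳ (length xs))

  ∑-++ : ∀ xs ys (f : A → ℕ) → ∑ (xs ++ ys) f ≡ ∑ xs f + ∑ ys f
  ∑-++ []       ys f = refl
  ∑-++ (x ∷ xs) ys f = trans (cong (_+_ (f x)) (∑-++ xs ys f)) (sym (+-assoc (f x) (∑ xs f) (∑ ys f)))

module _ {A B : Set} where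

  ∑-map : ∀ (g : A → B) xs (f : B → ℕ) → ∑ (map g xs) f ≡ ∑[ x ← xs ] f (g x)
  ∑-map g []       f = refl
  ∑-map g (x ∷ xs) f = cong (_+_ (f (g x))) (∑-map g xs f)

  ∑-concatMap : ∀ (g : A → List B) xs (f : B → ℕ) → ∑ (concatMap g xs) f ≡ ∑[ x ← xs ] ∑ (g x) f
  ∑-concatMap g []       f = refl
  ∑-concatMap g (x ∷ xs) f = trans (∑-++ (g x) (concatMap g xs) f) (cong (_+_ (∑ (g x) f)) (∑-concatMap g xs f))

  ∑-comm : ∀ xs ys (f : A → B → ℕ) → ∑[ x ← xs ] ∑[ y ← ys ] f x y ≡ ∑[ y ← ys ] ∑[ x ← xs ] f x y
  ∑-comm []       ys f = sym (∑-zero ys)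
  ∑-comm (x ∷ xs) ys f = trans (cong (_+_ (∑ ys (f x))) (∑-comm xs ys f))
                               (sym (∑-distrib-+ ys (f x) (λ y → ∑[ x ← xs ] f x y)))

∑-allFin-suc : ∀ n (f : Fin (suc n) → ℕ) → ∑ (allFin (suc n)) f ≡ f Fin.zero + (∑[ i ← allFin n ] f (Fin.suc i))
∑-allFin-suc n f = cong (_+_ (f Fin.zero)) (trans (cong (λ xs → ∑ xs f) (sym (List.map-tabulate (λ i → i) Fin.suc)))
                                               (∑-map Fin.suc (allFin n) f))

length-allFin : ∀ n → length (allFin n) ≡ n
length-allFin n = List.length-tabulate (λ i → i)

∑-allFin-const : ∀ n c → ∑[ i ← allFin n ] c ≡ n * c
∑-allFin-const n c = trans (∑-const (allFin n) c) (cong (_* c) (length-allFin n))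

module _ {A : Set} (p : A → Bool) where

  length-filter : ∀ xs → length (filter (λ x → p x Bool.≟ true) xs) ≡ ∑[ x ← xs ] 𝟙 (p x)
  length-filter []       = refl
  length-filter (x ∷ xs) with p x
  ... | true  = cong suc (length-filter xs)
  ... | false = length-filter xs

  ∑-filter : ∀ xs (g : A → ℕ) → ∑ (filter (λ x → p x Bool.≟ true) xs) g ≡ ∑[ x ← xs ] 𝟙 (p x) * g x
  ∑-filter []       g = refl
  ∑-filter (x ∷ xs) g with p x
  ... | true  = cong₂ _+_ (sym (+-identityʳ (g x))) (∑-filter xs g)
  ... | false = ∑-filter xs g

module Enumeration {A : Set} (_≟_ : DecidableEquality A) where

  δ : A → A → ℕ
  δ x y = 𝟙 (does (x ≟ y))

  δ-refl : ∀ x → δ x x ≡ 1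
  δ-refl x with x ≟ x
  ... | yes _   = refl
  ... | no x≢x = ⊥-elim (x≢x refl)

  δ-*-subst : ∀ x y (g : A → ℕ) → δ x y * g y ≡ δ x y * g x
  δ-*-subst x y g with x ≟ y
  ... | yes refl = refl
  ... | no _     = refl

  δ-≢ : ∀ {x y} → x ≢ y → δ x y ≡ 0
  δ-≢ {x} {y} x≢y = cong 𝟙 (dec-false (x ≟ y) x≢y)

  IsEnumeration : List A → Set
  IsEnumeration xs = ∀ x → ∑[ y ← xs ] δ x y ≡ 1

  module _ {xs : List A} (enum : IsEnumeration xs) where

    ∑-δ : ∀ x (g : A → ℕ) → ∑[ y ← xs ] δ x y * g y ≡ g x
    ∑-δ x g = begin
      ∑[ y ← xs ] δ x y * g y ≡⟨ ∑-cong xs (λ y → δ-*-subst x y g) ⟩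
      ∑[ y ← xs ] δ x y * g x ≡⟨ ∑-*ʳ xs (g x) (δ x) ⟩
      ∑ xs (δ x) * g x        ≡⟨ cong (_* g x) (enum x) ⟩
      1 * g x                 ≡⟨ *-identityˡ (g x) ⟩
      g x                     ∎
      where open ≡-Reasoning

    ≤-∑ : ∀ x (g : A → ℕ) → g x ≤ ∑ xs g
    ≤-∑ x g = begin
      g x                     ≡⟨ ∑-δ x g ⟨
      ∑[ y ← xs ] δ x y * g y ≤⟨ ∑-mono-≤ xs (λ y → *-monoˡ-≤ (g y) (𝟙≤1 (does (x ≟ y)))) ⟩
      ∑[ y ← xs ] 1 * g y     ≡⟨ ∑-cong xs (λ y → *-identityˡ (g y)) ⟩
      ∑ xs g                  ∎
      where open ≤-Reasoning

    ∑-reindex : ∀ (c d : A → A) → (∀ x → d (c x) ≡ x) → (∀ y → c (d y) ≡ y) →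
                ∀ (g : A → ℕ) → ∑[ x ← xs ] g (c x) ≡ ∑ xs g
    ∑-reindex c d dc cd g = begin
      ∑[ x ← xs ] g (c x)                         ≡⟨ ∑-cong xs (λ x → ∑-δ (c x) g) ⟨
      ∑[ x ← xs ] ∑[ y ← xs ] δ (c x) y * g y     ≡⟨ ∑-comm xs xs (λ x y → δ (c x) y * g y) ⟩
      ∑[ y ← xs ] ∑[ x ← xs ] δ (c x) y * g y     ≡⟨ ∑-cong xs (λ y → ∑-*ʳ xs (g y) (λ x → δ (c x) y)) ⟩
      ∑[ y ← xs ] (∑[ x ← xs ] δ (c x) y) * g y   ≡⟨ ∑-cong xs (λ y → cong (_* g y) (count y)) ⟩
      ∑[ y ← xs ] 1 * g y                         ≡⟨ ∑-cong xs (λ y → *-identityˡ (g y)) ⟩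
      ∑ xs g                                      ∎
      where
      open ≡-Reasoning
      δ-c : ∀ x y → δ (c x) y ≡ δ (d y) x
      δ-c x y with c x ≟ y | d y ≟ x
      ... | yes _    | yes _    = refl
      ... | no _     | no _     = refl
      ... | yes cx≡y | no dy≢x = ⊥-elim (dy≢x (trans (cong d (sym cx≡y)) (dc x)))
      ... | no cx≢y  | yes dy≡x = ⊥-elim (cx≢y (trans (cong c (sym dy≡x)) (cd y)))
      count : ∀ y → ∑[ x ← xs ] δ (c x) y ≡ 1
      count y = trans (∑-cong xs (λ x → δ-c x y)) (enum (d y))

open module FinEnumeration {n : ℕ} = Enumeration (Fin._≟_ {n})
  using (δ; δ-refl; δ-≢; IsEnumeration)

module WordEnumeration {n m : ℕ} = Enumeration (≡-dec {n = m} (Fin._≟_ {n}))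

allFin-isEnumeration : ∀ n → IsEnumeration (allFin n)
allFin-isEnumeration (suc n) Fin.zero =
  trans (∑-allFin-suc n (δ Fin.zero)) (cong suc (∑-zero (allFin n)))
allFin-isEnumeration (suc n) (Fin.suc x) =
  trans (∑-allFin-suc n (δ (Fin.suc x))) (allFin-isEnumeration n x)

allWords-isEnumeration : ∀ n m → WordEnumeration.IsEnumeration (allWords n m)
allWords-isEnumeration n zero    []      = refl
allWords-isEnumeration n (suc m) (a ∷ u) = begin
  ∑[ w ← allWords n (suc m) ] δʷ (a ∷ u) w
    ≡⟨ ∑-concatMap (λ b → map (b ∷_) W) (allFin n) (δʷ (a ∷ u)) ⟩
  ∑[ b ← allFin n ] ∑ (map (b ∷_) W) (δʷ (a ∷ u))
    ≡⟨ ∑-cong (allFin n) (λ b → ∑-map (b ∷_) W (δʷ (a ∷ u))) ⟩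
  ∑[ b ← allFin n ] ∑[ w ← W ] δʷ (a ∷ u) (b ∷ w)
    ≡⟨ ∑-cong (allFin n) (λ b → ∑-cong W (λ w → 𝟙-∧ (does (a Fin.≟ b)) _)) ⟩
  ∑[ b ← allFin n ] ∑[ w ← W ] δ a b * δʷ u w
    ≡⟨ ∑-cong (allFin n) (λ b → ∑-*ˡ W (δ a b) (δʷ u)) ⟩
  ∑[ b ← allFin n ] δ a b * ∑ W (δʷ u)
    ≡⟨ ∑-cong (allFin n) (λ b → cong (δ a b *_) (allWords-isEnumeration n m u)) ⟩
  ∑[ b ← allFin n ] δ a b * 1
    ≡⟨ ∑-cong (allFin n) (λ b → *-identityʳ (δ a b)) ⟩
  ∑[ b ← allFin n ] δ a b
    ≡⟨ allFin-isEnumeration n a ⟩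
  1 ∎
  where
  open ≡-Reasoning
  open WordEnumeration renaming (δ to δʷ)
  W = allWords n m

δ-injective : ∀ {m n} (f : Fin m → Fin n) → (∀ {x y} → f x ≡ f y → x ≡ y) → ∀ x y → δ (f x) (f y) ≡ δ x y
δ-injective f f-inj x y with x Fin.≟ y
... | yes refl = δ-refl (f x)
... | no  x≢y  = δ-≢ (x≢y ∘ f-inj)

-- Increasing lists

all-insertAt : ∀ {A : Set} (p : A → Bool) xs i y → all p (insertAt xs i y) ≡ p y ∧ all p xs
all-insertAt p xs       Fin.zero    y = refl
all-insertAt p (x ∷ xs) (Fin.suc i) y = trans (cong (p x ∧_) (all-insertAt p xs i y)) (∧-swap (p x) (p y) (all p xs))
  where
  ∧-swap : ∀ a b c → a ∧ (b ∧ c) ≡ b ∧ (a ∧ c)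
  ∧-swap false b     c = sym (∧-zeroʳ b)
  ∧-swap true  false c = refl
  ∧-swap true  true  c = refl

all-mono : ∀ {A : Set} {p q : A → Bool} → (∀ x → T (p x) → T (q x)) → ∀ xs → T (all p xs) → T (all q xs)
all-mono {p = p} {q} p⇒q xs = all⁻ q ∘ All.map (λ {x} → p⇒q x) ∘ all⁺ p xs

module _ {A : Set} (f : A → ℕ) where

  increasing : List A → Bool
  increasing []       = true
  increasing (x ∷ xs) = all (λ y → does (f x <? f y)) xs ∧ increasing xs

  increasing-tabulate : ∀ {n} (g : Fin n → A) →
                        T (increasing (tabulate g)) ⇔ (∀ {i j} → i Fin.< j → f (g i) < f (g j))
  increasing-tabulate g = mk⇔ (sound g) (complete g)
    where
    sound : ∀ {n} (g : Fin n → A) → T (increasing (tabulate g)) → ∀ {i j} → i Fin.< j → f (g i) < f (g j)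
    sound g t {Fin.zero}  {Fin.suc j} _ = <ᵇ⇒< _ _ (tabulate⁻ (all⁺ _ _ (proj₁ (Equivalence.to T-∧ t))) j)
    sound g t {Fin.suc i} {Fin.suc j} (s≤s i<j) = sound (g ∘ Fin.suc) (proj₂ (Equivalence.to T-∧ t)) i<j
    complete : ∀ {n} (g : Fin n → A) → (∀ {i j} → i Fin.< j → f (g i) < f (g j)) → T (increasing (tabulate g))
    complete {zero}  g mono = tt
    complete {suc n} g mono = Equivalence.from T-∧
      ( all⁻ _ (tabulate⁺ (λ j → <⇒<ᵇ (mono {Fin.zero} {Fin.suc j} (s≤s z≤n))))
      , complete (g ∘ Fin.suc) (λ i<j → mono (s≤s i<j)))

  -- If f y < f x, every constraint on y in y ∷ x ∷ xs follows from those on x.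
  increasing-split : ∀ {x y} xs → f x ≢ f y →
    𝟙 (increasing (y ∷ x ∷ xs)) + 𝟙 (does (f x <? f y) ∧ increasing (x ∷ xs)) ≡ 𝟙 (increasing (x ∷ xs))
  increasing-split {x} {y} xs fx≢fy with <-cmp (f x) (f y)
  ... | tri≈ _ fx≡fy _ = ⊥-elim (fx≢fy fx≡fy)
  ... | tri< fx<fy _ fy≮fx rewrite dec-true (f x <? f y) fx<fy | dec-false (f y <? f x) fy≮fx = refl
  ... | tri> fx≮fy _ fy<fx rewrite dec-false (f x <? f y) fx≮fy | dec-true (f y <? f x) fy<fx =
    absorb (all (λ z → does (f x <? f z)) xs) _ (increasing xs)
           (all-mono (λ z → <⇒<ᵇ ∘ <-trans fy<fx ∘ <ᵇ⇒< (f x) (f z)) xs)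
    where
    absorb : ∀ X Y R → (T X → T Y) → 𝟙 (Y ∧ (X ∧ R)) + 0 ≡ 𝟙 (X ∧ R)
    absorb false Y     R _   = cong (λ b → 𝟙 b + 0) (∧-zeroʳ Y)
    absorb true  true  R _   = +-identityʳ (𝟙 R)
    absorb true  false R X⇒Y = ⊥-elim (X⇒Y tt)

  module _ (f-injective : ∀ {x y} → f x ≡ f y → x ≡ y) where

    ∑-increasing-insertAt : ∀ xs y → All (y ≢_) xs →
      ∑[ i ← allFin (suc (length xs)) ] 𝟙 (increasing (insertAt xs i y)) ≡ 𝟙 (increasing xs)
    ∑-increasing-insertAt []       y []           = refl
    ∑-increasing-insertAt (x ∷ xs) y (y≢x ∷ xs∌y) = begin
      ∑[ i ← allFin (suc (length (x ∷ xs))) ] 𝟙 (increasing (insertAt (x ∷ xs) i y))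
        ≡⟨ ∑-allFin-suc (suc (length xs)) (λ i → 𝟙 (increasing (insertAt (x ∷ xs) i y))) ⟩
      𝟙 (increasing (y ∷ x ∷ xs)) + (∑[ i ← I ] 𝟙 (below-x (insertAt xs i y) ∧ increasing (insertAt xs i y)))
        ≡⟨ cong (_+_ (𝟙 (increasing (y ∷ x ∷ xs)))) inserted-after-x ⟩
      𝟙 (increasing (y ∷ x ∷ xs)) + 𝟙 (x<y ∧ increasing (x ∷ xs))
        ≡⟨ increasing-split xs (y≢x ∘ sym ∘ f-injective) ⟩
      𝟙 (increasing (x ∷ xs)) ∎
      where
      open ≡-Reasoning
      I = allFin (suc (length xs))
      below-x = all (λ z → does (f x <? f z))
      x<y = does (f x <? f y)
      inserted-after-x : ∑[ i ← I ] 𝟙 (below-x (insertAt xs i y) ∧ increasing (insertAt xs i y)) ≡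
                         𝟙 (x<y ∧ increasing (x ∷ xs))
      inserted-after-x = begin
        ∑[ i ← I ] 𝟙 (below-x (insertAt xs i y) ∧ increasing (insertAt xs i y))
          ≡⟨ ∑-cong I (λ i → trans (cong (λ b → 𝟙 (b ∧ _)) (all-insertAt _ xs i y)) (𝟙-∧ (below-x (y ∷ xs)) _)) ⟩
        ∑[ i ← I ] 𝟙 (below-x (y ∷ xs)) * 𝟙 (increasing (insertAt xs i y))
          ≡⟨ ∑-*ˡ I (𝟙 (below-x (y ∷ xs))) _ ⟩
        𝟙 (below-x (y ∷ xs)) * (∑[ i ← I ] 𝟙 (increasing (insertAt xs i y)))
          ≡⟨ cong (𝟙 (below-x (y ∷ xs)) *_) (∑-increasing-insertAt xs y xs∌y) ⟩
        𝟙 (below-x (y ∷ xs)) * 𝟙 (increasing xs)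
          ≡⟨ 𝟙-∧ (below-x (y ∷ xs)) _ ⟨
        𝟙 ((x<y ∧ below-x xs) ∧ increasing xs)
          ≡⟨ cong 𝟙 (∧-assoc x<y (below-x xs) (increasing xs)) ⟩
        𝟙 (x<y ∧ increasing (x ∷ xs)) ∎

increasing-map : ∀ {A B : Set} (f : A → ℕ) (g : B → A) (h : B → ℕ) → (∀ x → f (g x) ≡ h x) →
                 ∀ xs → increasing f (map g xs) ≡ increasing h xs
increasing-map f g h fg≗h []       = refl
increasing-map f g h fg≗h (x ∷ xs) = cong₂ _∧_
  (cong and (trans (sym (List.map-∘ xs)) (List.map-cong (λ y → cong₂ (λ u v → does (u <? v)) (fg≗h x) (fg≗h y)) xs)))
  (increasing-map f g h fg≗h xs)

unique-middle : ∀ {A : Set} (p : List A) {x q} → Unique (p ++ x ∷ q) → All (x ≢_) (p ++ q)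
unique-middle []      (x∉q ∷ _)    = x∉q
unique-middle (a ∷ p) (a∉rest ∷ u) =
  (λ x≡a → All.lookup a∉rest (∈-++⁺ʳ p (here refl)) (sym x≡a)) ∷ unique-middle p u

-- Transpositions

transpose-matchˡ : ∀ {n} (i j : Fin n) → transpose i j i ≡ j
transpose-matchˡ i j rewrite dec-true (i Fin.≟ i) refl = refl

transpose-matchʳ : ∀ {n} (i j : Fin n) → transpose i j j ≡ i
transpose-matchʳ i j with j Fin.≟ i
... | yes j≡i = j≡i
... | no  _   rewrite dec-true (j Fin.≟ j) refl = refl

transpose-other : ∀ {n} {i j k : Fin n} → k ≢ i → k ≢ j → transpose i j k ≡ k
transpose-other {i = i} {j} {k} k≢i k≢j rewrite dec-false (k Fin.≟ i) k≢i | dec-false (k Fin.≟ j) k≢j = refl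

transpose-involutive : ∀ {n} (i j k : Fin n) → transpose i j (transpose i j k) ≡ k
transpose-involutive i j k = by-cases (k Fin.≟ i) (k Fin.≟ j)
  where
  by-cases : Dec (k ≡ i) → Dec (k ≡ j) → transpose i j (transpose i j k) ≡ k
  by-cases (yes refl) _          = trans (cong (transpose k j) (transpose-matchˡ k j)) (transpose-matchʳ k j)
  by-cases (no _)     (yes refl) = trans (cong (transpose i k) (transpose-matchʳ i k)) (transpose-matchˡ i k)
  by-cases (no k≢i)   (no k≢j)   = trans (cong (transpose i j) (transpose-other k≢i k≢j)) (transpose-other k≢i k≢j)

transpose-inject : ∀ {m n} (f : Fin m → Fin n) → (∀ {x y} → f x ≡ f y → x ≡ y) →
                   ∀ i j k → transpose (f i) (f j) (f k) ≡ f (transpose i j k)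
transpose-inject f f-inj i j k = by-cases (k Fin.≟ i) (k Fin.≟ j)
  where
  by-cases : Dec (k ≡ i) → Dec (k ≡ j) → transpose (f i) (f j) (f k) ≡ f (transpose i j k)
  by-cases (yes refl) _          = trans (transpose-matchˡ (f k) (f j)) (cong f (sym (transpose-matchˡ k j)))
  by-cases (no _)     (yes refl) = trans (transpose-matchʳ (f i) (f k)) (cong f (sym (transpose-matchʳ i k)))
  by-cases (no k≢i)   (no k≢j)   =
    trans (transpose-other (k≢i ∘ f-inj) (k≢j ∘ f-inj)) (cong f (sym (transpose-other k≢i k≢j)))

map-transpose-id : ∀ {n} {x y : Fin n} {zs} → All (x ≢_) zs → All (y ≢_) zs → map (transpose x y) zs ≡ zs
map-transpose-id x∉zs y∉zs =
  List.map-id-local (All.zipWith (λ (x≢z , y≢z) → transpose-other (x≢z ∘ sym) (y≢z ∘ sym)) (x∉zs , y∉zs))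

-- Involutions

Word : ℕ → Set
Word n = Vec (Fin n) n

words : ∀ n → List (Word n)
words n = allWords n n

IsInvolution : ∀ {n} → Word n → Set
IsInvolution φ = ∀ i → lookup φ (lookup φ i) ≡ i

T-all-allFin : ∀ {n} (p : Fin n → Bool) → T (all p (allFin n)) ⇔ (∀ i → T (p i))
T-all-allFin p = mk⇔ (λ t i → All.lookup (all⁺ p _ t) (∈-allFin i)) (λ h → all⁻ p (tabulate⁺ h))

T-isInvolution : ∀ {n} (φ : Word n) → T (isInvolution φ) ⇔ IsInvolution φ
T-isInvolution φ = mk⇔ (λ t i → toWitness {a? = fixes? i} (Equivalence.to (T-all-allFin (⌊_⌋ ∘ fixes?)) t i))
                       (λ inv → Equivalence.from (T-all-allFin (⌊_⌋ ∘ fixes?)) (λ i → fromWitness (inv i)))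
  where
  fixes? = λ i → lookup φ (lookup φ i) Fin.≟ i

involution-injective : ∀ {n} (φ : Word n) → IsInvolution φ → ∀ {x y} → lookup φ x ≡ lookup φ y → x ≡ y
involution-injective φ inv {x} {y} φx≡φy = trans (sym (inv x)) (trans (cong (lookup φ) φx≡φy) (inv y))

conj : ∀ {n} → (Fin n → Fin n) → Word n → Word n
conj π φ = Vec.tabulate (λ x → π (lookup φ (π x)))

lookup-conj : ∀ {n} (π : Fin n → Fin n) (φ : Word n) x → lookup (conj π φ) x ≡ π (lookup φ (π x))
lookup-conj π φ = Vec.lookup∘tabulate _

module Conjugation {n} {π : Fin n → Fin n} (π-involutive : ∀ x → π (π x) ≡ x) where

  conj-involutive : ∀ φ → conj π (conj π φ) ≡ φ
  conj-involutive φ = trans (Vec.tabulate-cong λ x → begin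
      π (lookup (conj π φ) (π x))  ≡⟨ cong π (lookup-conj π φ (π x)) ⟩
      π (π (lookup φ (π (π x))))   ≡⟨ π-involutive _ ⟩
      lookup φ (π (π x))           ≡⟨ cong (lookup φ) (π-involutive x) ⟩
      lookup φ x                   ∎)
    (Vec.tabulate∘lookup φ)
    where open ≡-Reasoning

  conj-isInvolution : ∀ φ → IsInvolution φ → IsInvolution (conj π φ)
  conj-isInvolution φ inv x = begin
    lookup (conj π φ) (lookup (conj π φ) x)  ≡⟨ lookup-conj π φ _ ⟩
    π (lookup φ (π (lookup (conj π φ) x)))   ≡⟨ cong (λ y → π (lookup φ (π y))) (lookup-conj π φ x) ⟩
    π (lookup φ (π (π (lookup φ (π x)))))    ≡⟨ cong (λ y → π (lookup φ y)) (π-involutive _) ⟩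
    π (lookup φ (lookup φ (π x)))            ≡⟨ cong π (inv (π x)) ⟩
    π (π x)                                  ≡⟨ π-involutive x ⟩
    x                                        ∎
    where open ≡-Reasoning

  isInvolution-conj : ∀ φ → isInvolution (conj π φ) ≡ isInvolution φ
  isInvolution-conj φ = T-injective (mk⇔
    (λ t → from φ (subst IsInvolution (conj-involutive φ) (conj-isInvolution (conj π φ) (to (conj π φ) t))))
    (λ t → from (conj π φ) (conj-isInvolution φ (to φ t))))
    where
    to : ∀ ψ → T (isInvolution ψ) → IsInvolution ψ
    to ψ = Equivalence.to (T-isInvolution ψ)
    from : ∀ ψ → IsInvolution ψ → T (isInvolution ψ)
    from ψ = Equivalence.from (T-isInvolution ψ)

  ∑-conj : ∀ (g : Word n → ℕ) → ∑[ φ ← words n ] g (conj π φ) ≡ ∑ (words n) g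
  ∑-conj = WordEnumeration.∑-reindex {xs = words n} (allWords-isEnumeration n n)
             (conj π) (conj π) conj-involutive conj-involutive

ι : ∀ {n} → Word n → ℕ
ι φ = 𝟙 (isInvolution φ)

#Inv : ℕ → ℕ
#Inv n = ∑ (words n) ι

#Inv[_↦_] : ∀ {n} → Fin n → Fin n → ℕ
#Inv[_↦_] {n} u v = ∑[ φ ← words n ] ι φ * δ (lookup φ u) v

#Inv-positive : ∀ n → 1 ≤ #Inv n
#Inv-positive n = ≤-trans (≤-reflexive (sym (cong 𝟙 identity-is-involution)))
                          (WordEnumeration.≤-∑ {xs = words n} (allWords-isEnumeration n n) identity ι)
  where
  identity : Word n
  identity = Vec.tabulate (λ i → i)
  identity-is-involution : isInvolution identity ≡ true
  identity-is-involution = Equivalence.to T-≡ (Equivalence.from (T-isInvolution identity) λ i →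
    trans (cong (lookup identity) (Vec.lookup∘tabulate _ i)) (Vec.lookup∘tabulate _ i))

module _ {n : ℕ} where

  #Inv-row : ∀ (u : Fin n) → ∑[ v ← allFin n ] #Inv[ u ↦ v ] ≡ #Inv n
  #Inv-row u = begin
    ∑[ v ← allFin n ] ∑[ φ ← words n ] ι φ * δ (lookup φ u) v
      ≡⟨ ∑-comm (words n) (allFin n) _ ⟨
    ∑[ φ ← words n ] ∑[ v ← allFin n ] ι φ * δ (lookup φ u) v
      ≡⟨ ∑-cong (words n) (λ φ → ∑-*ˡ (allFin n) (ι φ) _) ⟩
    ∑[ φ ← words n ] ι φ * ∑ (allFin n) (δ (lookup φ u))
      ≡⟨ ∑-cong (words n) (λ φ → cong (ι φ *_) (allFin-isEnumeration n (lookup φ u))) ⟩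
    ∑[ φ ← words n ] ι φ * 1
      ≡⟨ ∑-cong (words n) (λ φ → *-identityʳ (ι φ)) ⟩
    #Inv n ∎
    where open ≡-Reasoning

  #Inv-conj : ∀ (π : Fin n → Fin n) → (∀ x → π (π x) ≡ x) → ∀ u v → #Inv[ π u ↦ π v ] ≡ #Inv[ u ↦ v ]
  #Inv-conj π π-involutive u v = begin
    ∑[ φ ← words n ] ι φ * δ (lookup φ (π u)) (π v)
      ≡⟨ ∑-conj _ ⟨
    ∑[ φ ← words n ] ι (conj π φ) * δ (lookup (conj π φ) (π u)) (π v)
      ≡⟨ ∑-cong (words n) (λ φ → cong₂ _*_ (cong 𝟙 (isInvolution-conj φ)) (δ-conj φ)) ⟩
    ∑[ φ ← words n ] ι φ * δ (lookup φ u) v ∎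
    where
    open ≡-Reasoning
    open Conjugation {π = π} π-involutive
    π-injective : ∀ {x y} → π x ≡ π y → x ≡ y
    π-injective {x} {y} πx≡πy = trans (sym (π-involutive x)) (trans (cong π πx≡πy) (π-involutive y))
    δ-conj : ∀ φ → δ (lookup (conj π φ) (π u)) (π v) ≡ δ (lookup φ u) v
    δ-conj φ = trans (cong (λ w → δ w (π v)) (trans (lookup-conj π φ (π u)) (cong (π ∘ lookup φ) (π-involutive u))))
                     (δ-injective π π-injective (lookup φ u) v)

  #Inv-transpose : ∀ u {v w} → u ≢ v → u ≢ w → #Inv[ u ↦ w ] ≡ #Inv[ u ↦ v ]
  #Inv-transpose u {v} {w} u≢v u≢w = begin
    #Inv[ u ↦ w ]
      ≡⟨ cong₂ #Inv[_↦_] (transpose-other u≢v u≢w) (transpose-matchˡ v w) ⟨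
    #Inv[ transpose v w u ↦ transpose v w v ]
      ≡⟨ #Inv-conj (transpose v w) (transpose-involutive v w) u v ⟩
    #Inv[ u ↦ v ] ∎
    where open ≡-Reasoning

  -- That is, (n − 1) · #Inv[ u ↦ v ] ≤ #Inv n: #Inv[ u ↦ y ] is the same for all y ≢ u.
  #Inv-off-diagonal : ∀ {u v : Fin n} → u ≢ v → n * #Inv[ u ↦ v ] ≤ #Inv n + #Inv[ u ↦ v ]
  #Inv-off-diagonal {u} {v} u≢v = begin
    n * #Inv[ u ↦ v ]
      ≡⟨ ∑-allFin-const n _ ⟨
    ∑[ y ← allFin n ] #Inv[ u ↦ v ]
      ≤⟨ ∑-mono-≤ (allFin n) pointwise ⟩
    ∑[ y ← allFin n ] (#Inv[ u ↦ y ] + δ u y * #Inv[ u ↦ v ])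
      ≡⟨ ∑-distrib-+ (allFin n) _ _ ⟩
    (∑[ y ← allFin n ] #Inv[ u ↦ y ]) + (∑[ y ← allFin n ] δ u y * #Inv[ u ↦ v ])
      ≡⟨ cong₂ _+_ (#Inv-row u) (FinEnumeration.∑-δ {xs = allFin n} (allFin-isEnumeration n) u (λ _ → #Inv[ u ↦ v ])) ⟩
    #Inv n + #Inv[ u ↦ v ] ∎
    where
    open ≤-Reasoning
    pointwise : ∀ y → #Inv[ u ↦ v ] ≤ #Inv[ u ↦ y ] + δ u y * #Inv[ u ↦ v ]
    pointwise y with u Fin.≟ y
    ... | yes refl = ≤-trans (≤-reflexive (sym (*-identityˡ _))) (m≤n+m _ #Inv[ u ↦ u ])
    ... | no  u≢y  = ≤-trans (≤-reflexive (sym (#Inv-transpose u u≢v u≢y))) (m≤m+n _ 0)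

  post : (Fin n → Fin n) → Word n → Word n
  post π φ = Vec.tabulate (π ∘ lookup φ)

  lookup-post : ∀ π (φ : Word n) x → lookup (post π φ) x ≡ π (lookup φ x)
  lookup-post π φ = Vec.lookup∘tabulate _

  post-involutive : ∀ {π} → (∀ x → π (π x) ≡ x) → ∀ φ → post π (post π φ) ≡ φ
  post-involutive {π} π-involutive φ =
    trans (Vec.tabulate-cong (λ x → trans (cong π (lookup-post π φ x)) (π-involutive _))) (Vec.tabulate∘lookup φ)

  transpose-fixed-points : ∀ {x y} φ → IsInvolution φ → lookup φ x ≡ x → lookup φ y ≡ y →
                           IsInvolution (post (transpose x y) φ)
  transpose-fixed-points {x} {y} φ inv φx≡x φy≡y z = begin
    lookup (post π φ) (lookup (post π φ) z)  ≡⟨ lookup-post π φ _ ⟩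
    π (lookup φ (lookup (post π φ) z))      ≡⟨ cong (π ∘ lookup φ) (lookup-post π φ z) ⟩
    π (lookup φ (π (lookup φ z)))           ≡⟨ by-cases (z Fin.≟ x) (z Fin.≟ y) ⟩
    z                                       ∎
    where
    open ≡-Reasoning
    π = transpose x y
    by-cases : Dec (z ≡ x) → Dec (z ≡ y) → π (lookup φ (π (lookup φ z))) ≡ z
    by-cases (yes refl) _ = begin
      π (lookup φ (π (lookup φ z)))  ≡⟨ cong (π ∘ lookup φ ∘ π) φx≡x ⟩
      π (lookup φ (π z))             ≡⟨ cong (π ∘ lookup φ) (transpose-matchˡ z y) ⟩
      π (lookup φ y)                 ≡⟨ cong π φy≡y ⟩
      π y                            ≡⟨ transpose-matchʳ z y ⟩
      z                              ∎
    by-cases (no _) (yes refl) = begin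
      π (lookup φ (π (lookup φ z)))  ≡⟨ cong (π ∘ lookup φ ∘ π) φy≡y ⟩
      π (lookup φ (π z))             ≡⟨ cong (π ∘ lookup φ) (transpose-matchʳ x z) ⟩
      π (lookup φ x)                 ≡⟨ cong π φx≡x ⟩
      π x                            ≡⟨ transpose-matchˡ x z ⟩
      z                              ∎
    by-cases (no z≢x) (no z≢y) = begin
      π (lookup φ (π (lookup φ z)))
        ≡⟨ cong (π ∘ lookup φ) (transpose-other (moved z≢x φx≡x) (moved z≢y φy≡y)) ⟩
      π (lookup φ (lookup φ z))
        ≡⟨ cong π (inv z) ⟩
      π z
        ≡⟨ transpose-other z≢x z≢y ⟩
      z ∎
      where
      moved : ∀ {w} → z ≢ w → lookup φ w ≡ w → lookup φ z ≢ w
      moved z≢w φw≡w φz≡w = z≢w (involution-injective φ inv (trans φz≡w (sym φw≡w)))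

  -- Fixed points

  fixed : Word n → Fin n → ℕ
  fixed φ x = δ (lookup φ x) x

  #Inv-fixed-pair : ∀ {x y : Fin n} → x ≢ y →
    ∑[ φ ← words n ] ι φ * (fixed φ x * fixed φ y) ≤ #Inv[ x ↦ y ]
  #Inv-fixed-pair {x} {y} x≢y = begin
    ∑[ φ ← words n ] ι φ * (fixed φ x * fixed φ y)             ≤⟨ ∑-mono-≤ (words n) pointwise ⟩
    ∑[ φ ← words n ] ι (post π φ) * δ (lookup (post π φ) x) y  ≡⟨ reindex (λ φ → ι φ * δ (lookup φ x) y) ⟩
    #Inv[ x ↦ y ]                                             ∎
    where
    open ≤-Reasoning
    π = transpose x y
    reindex : ∀ g → ∑[ φ ← words n ] g (post π φ) ≡ ∑ (words n) g
    reindex = WordEnumeration.∑-reindex {xs = words n} (allWords-isEnumeration n n) (post π) (post π)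
                (post-involutive {π} (transpose-involutive x y)) (post-involutive {π} (transpose-involutive x y))
    pointwise : ∀ φ → ι φ * (fixed φ x * fixed φ y) ≤ ι (post π φ) * δ (lookup (post π φ) x) y
    pointwise φ with isInvolution φ in inv? | lookup φ x Fin.≟ x | lookup φ y Fin.≟ y
    ... | false | _          | _          = z≤n
    ... | true  | no _       | _          = z≤n
    ... | true  | yes _      | no _       = z≤n
    ... | true  | yes φx≡x   | yes φy≡y   = ≤-reflexive (sym (cong₂ _*_
      (cong 𝟙 (Equivalence.to T-≡ (Equivalence.from (T-isInvolution (post π φ))
        (transpose-fixed-points φ (Equivalence.to (T-isInvolution φ) (Equivalence.from T-≡ inv?)) φx≡x φy≡y))))
      (trans (cong (λ w → δ w y) (trans (lookup-post π φ x) (trans (cong π φx≡x) (transpose-matchˡ x y)))) (δ-refl y))))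

  #Fix : Word n → ℕ
  #Fix φ = ∑[ x ← allFin n ] fixed φ x

  #Inv-diagonal-sum : ∑[ x ← allFin n ] #Inv[ x ↦ x ] ≡ ∑[ φ ← words n ] ι φ * #Fix φ
  #Inv-diagonal-sum = trans (∑-comm (allFin n) (words n) _)
                            (∑-cong (words n) (λ φ → ∑-*ˡ (allFin n) (ι φ) (fixed φ)))

  #Inv-diagonal : ∀ u → n * #Inv[ u ↦ u ] ≡ ∑[ x ← allFin n ] #Inv[ x ↦ x ]
  #Inv-diagonal u = trans (sym (∑-allFin-const n _)) (∑-cong (allFin n) λ x → begin
    #Inv[ u ↦ u ]                              ≡⟨ #Inv-conj (transpose u x) (transpose-involutive u x) u u ⟨
    #Inv[ transpose u x u ↦ transpose u x u ]  ≡⟨ cong (λ w → #Inv[ w ↦ w ]) (transpose-matchˡ u x) ⟩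
    #Inv[ x ↦ x ]                              ∎)
    where open ≡-Reasoning

  #Inv-pair-bound : ∀ x y →
    ∑[ φ ← words n ] ι φ * (fixed φ x * fixed φ y) ≤ #Inv[ x ↦ y ] + δ x y * #Inv[ x ↦ x ]
  #Inv-pair-bound x y with x Fin.≟ y
  ... | no  x≢y  = ≤-trans (#Inv-fixed-pair x≢y) (m≤m+n _ 0)
  ... | yes refl = ≤-trans (∑-mono-≤ (words n) λ φ → *-monoʳ-≤ (ι φ) (fixed² φ)) (m≤m+n _ _)
    where
    fixed² : ∀ φ → fixed φ x * fixed φ x ≤ fixed φ x
    fixed² φ = ≤-trans (*-monoʳ-≤ (fixed φ x) (𝟙≤1 _)) (≤-reflexive (*-identityʳ _))

  #Fix-second-moment :
    ∑[ φ ← words n ] ι φ * (#Fix φ * #Fix φ) ≤ n * #Inv n + (∑[ φ ← words n ] ι φ * #Fix φ)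
  #Fix-second-moment = begin
    ∑[ φ ← words n ] ι φ * (#Fix φ * #Fix φ)
      ≡⟨ ∑-cong (words n) expand ⟩
    ∑[ φ ← words n ] ∑[ x ← allFin n ] ∑[ y ← allFin n ] ι φ * (fixed φ x * fixed φ y)
      ≡⟨ ∑-comm (words n) (allFin n) _ ⟩
    ∑[ x ← allFin n ] ∑[ φ ← words n ] ∑[ y ← allFin n ] ι φ * (fixed φ x * fixed φ y)
      ≡⟨ ∑-cong (allFin n) (λ x → ∑-comm (words n) (allFin n) _) ⟩
    ∑[ x ← allFin n ] ∑[ y ← allFin n ] ∑[ φ ← words n ] ι φ * (fixed φ x * fixed φ y)
      ≤⟨ ∑-mono-≤ (allFin n) (λ x → ∑-mono-≤ (allFin n) (#Inv-pair-bound x)) ⟩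
    ∑[ x ← allFin n ] ∑[ y ← allFin n ] (#Inv[ x ↦ y ] + δ x y * #Inv[ x ↦ x ])
      ≡⟨ ∑-cong (allFin n) row ⟩
    ∑[ x ← allFin n ] (#Inv n + #Inv[ x ↦ x ])
      ≡⟨ ∑-distrib-+ (allFin n) _ _ ⟩
    (∑[ x ← allFin n ] #Inv n) + (∑[ x ← allFin n ] #Inv[ x ↦ x ])
      ≡⟨ cong₂ _+_ (∑-allFin-const n (#Inv n)) #Inv-diagonal-sum ⟩
    n * #Inv n + (∑[ φ ← words n ] ι φ * #Fix φ) ∎
    where
    open ≤-Reasoning
    expand : ∀ φ → ι φ * (#Fix φ * #Fix φ) ≡ ∑[ x ← allFin n ] ∑[ y ← allFin n ] ι φ * (fixed φ x * fixed φ y)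
    expand φ = begin-equality
      ι φ * (#Fix φ * #Fix φ)
        ≡⟨ cong (ι φ *_) (∑-*ʳ (allFin n) (#Fix φ) (fixed φ)) ⟨
      ι φ * (∑[ x ← allFin n ] fixed φ x * #Fix φ)
        ≡⟨ ∑-*ˡ (allFin n) (ι φ) _ ⟨
      ∑[ x ← allFin n ] ι φ * (fixed φ x * #Fix φ)
        ≡⟨ ∑-cong (allFin n) (λ x → cong (ι φ *_) (∑-*ˡ (allFin n) (fixed φ x) (fixed φ)) ) ⟨
      ∑[ x ← allFin n ] ι φ * (∑[ y ← allFin n ] fixed φ x * fixed φ y) ≡⟨ ∑-cong (allFin n) (λ x → ∑-*ˡ (allFin n) (ι φ) _) ⟨
      ∑[ x ← allFin n ] ∑[ y ← allFin n ] ι φ * (fixed φ x * fixed φ y) ∎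
    row : ∀ x → ∑[ y ← allFin n ] (#Inv[ x ↦ y ] + δ x y * #Inv[ x ↦ x ]) ≡ #Inv n + #Inv[ x ↦ x ]
    row x = trans (∑-distrib-+ (allFin n) _ _)
                  (cong₂ _+_ (#Inv-row x) (FinEnumeration.∑-δ {xs = allFin n} (allFin-isEnumeration n) x (λ _ → #Inv[ x ↦ x ])))

  -- Second moment of the number F of fixed points: t F + F ≤ t² + F², and ∑ F² ≤ n · #Inv n + ∑ F.
  #Inv-diagonal-bound : ∀ u t → t * (n * #Inv[ u ↦ u ]) ≤ (t * t + n) * #Inv n
  #Inv-diagonal-bound u t =
    subst (_≤ (t * t + n) * #Inv n) (cong (t *_) (sym (trans (#Inv-diagonal u) #Inv-diagonal-sum)))
          (+-cancelʳ-≤ S₁ (t * S₁) ((t * t + n) * #Inv n) chain)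
    where
    open ≤-Reasoning
    S₁ = ∑[ φ ← words n ] ι φ * #Fix φ
    S₂ = ∑[ φ ← words n ] ι φ * (#Fix φ * #Fix φ)
    distribˡ : ∀ a t f → a * (t * f + f) ≡ t * (a * f) + a * f
    distribˡ = solve-∀
    regroup : ∀ I t n S → I * (t * t) + (n * I + S) ≡ (t * t + n) * I + S
    regroup = solve-∀
    chain : t * S₁ + S₁ ≤ (t * t + n) * #Inv n + S₁
    chain = begin
      t * S₁ + S₁
        ≡⟨ cong₂ _+_ (∑-*ˡ (words n) t _) refl ⟨
      (∑[ φ ← words n ] t * (ι φ * #Fix φ)) + S₁
        ≡⟨ ∑-distrib-+ (words n) _ _ ⟨
      ∑[ φ ← words n ] (t * (ι φ * #Fix φ) + ι φ * #Fix φ)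
        ≡⟨ ∑-cong (words n) (λ φ → distribˡ (ι φ) t (#Fix φ)) ⟨
      ∑[ φ ← words n ] ι φ * (t * #Fix φ + #Fix φ)
        ≤⟨ ∑-mono-≤ (words n) (λ φ → *-monoʳ-≤ (ι φ) (m*n+n≤m*m+n*n t (#Fix φ))) ⟩
      ∑[ φ ← words n ] ι φ * (t * t + #Fix φ * #Fix φ)
        ≡⟨ ∑-cong (words n) (λ φ → *-distribˡ-+ (ι φ) (t * t) _) ⟩
      ∑[ φ ← words n ] (ι φ * (t * t) + ι φ * (#Fix φ * #Fix φ))
        ≡⟨ ∑-distrib-+ (words n) _ _ ⟩
      (∑[ φ ← words n ] ι φ * (t * t)) + S₂
        ≡⟨ cong₂ _+_ (∑-*ʳ (words n) (t * t) ι) refl ⟩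
      #Inv n * (t * t) + S₂
        ≤⟨ +-monoʳ-≤ (#Inv n * (t * t)) #Fix-second-moment ⟩
      #Inv n * (t * t) + (n * #Inv n + S₁)
        ≡⟨ regroup (#Inv n) t n S₁ ⟩
      (t * t + n) * #Inv n + S₁ ∎

  #Inv-bound : ∀ {M} → M < n → 2 * M * (2 * M) ≤ n → ∀ u v → M * #Inv[ u ↦ v ] ≤ #Inv n
  #Inv-bound {M} M<n 4M²≤n u v with u Fin.≟ v
  ... | no u≢v = +-cancelˡ-≤ #Inv[ u ↦ v ] (M * #Inv[ u ↦ v ]) (#Inv n) (begin
    suc M * #Inv[ u ↦ v ]       ≤⟨ *-monoˡ-≤ #Inv[ u ↦ v ] M<n ⟩
    n * #Inv[ u ↦ v ]           ≤⟨ #Inv-off-diagonal u≢v ⟩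
    #Inv n + #Inv[ u ↦ v ]      ≡⟨ +-comm (#Inv n) _ ⟩
    #Inv[ u ↦ v ] + #Inv n      ∎)
    where open ≤-Reasoning
  ... | yes refl = *-cancelˡ-≤ 2 (*-cancelˡ-≤ n {{>-nonZero (m<n⇒0<n M<n)}} (begin
    n * (2 * (M * #Inv[ u ↦ u ]))      ≡⟨ swap n M #Inv[ u ↦ u ] ⟩
    2 * M * (n * #Inv[ u ↦ u ])        ≤⟨ #Inv-diagonal-bound u (2 * M) ⟩
    (2 * M * (2 * M) + n) * #Inv n     ≤⟨ *-monoˡ-≤ (#Inv n) (+-monoˡ-≤ n 4M²≤n) ⟩
    (n + n) * #Inv n                   ≡⟨ double n (#Inv n) ⟩
    n * (2 * #Inv n)                   ∎))
    where
    open ≤-Reasoning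
    swap : ∀ n M T → n * (2 * (M * T)) ≡ 2 * M * (n * T)
    swap = solve-∀
    double : ∀ n I → (n + n) * I ≡ n * (2 * I)
    double = solve-∀

-- Corner-free involutions

module Corner {k n : ℕ} (k≤n : k ≤ n) where

  -- The letters 1, …, k of σ are ↑ 0, …, ↑ (k − 1).
  ↑ : Fin k → Fin n
  ↑ i = Fin.inject≤ i k≤n

  toℕ-↑ : ∀ i → toℕ (↑ i) ≡ toℕ i
  toℕ-↑ i = Fin.toℕ-inject≤ i k≤n

  ↑-injective : ∀ {i j} → ↑ i ≡ ↑ j → i ≡ j
  ↑-injective {i} {j} ↑i≡↑j = Fin.toℕ-injective (trans (sym (toℕ-↑ i)) (trans (cong toℕ ↑i≡↑j) (toℕ-↑ j)))

  ↑-fromℕ< : ∀ {z : Fin n} (z<k : toℕ z < k) → ↑ (Fin.fromℕ< z<k) ≡ z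
  ↑-fromℕ< z<k = Fin.toℕ-injective (trans (toℕ-↑ _) (Fin.toℕ-fromℕ< z<k))

  ↑≢large : ∀ i {z : Fin n} → k ≤ toℕ z → z ≢ ↑ i
  ↑≢large i k≤z z≡↑i = <⇒≱ (subst (_< k) (sym (toℕ-↑ i)) (Fin.toℕ<n i)) (subst (λ w → k ≤ toℕ w) z≡↑i k≤z)

  CornerFree : Word n → Set
  CornerFree φ = ∀ i → k ≤ toℕ (lookup φ (↑ i))

  cornerFree? : ∀ φ → Dec (CornerFree φ)
  cornerFree? φ = Fin.all? (λ i → k ≤? toℕ (lookup φ (↑ i)))

  good : Word n → Bool
  good φ = isInvolution φ ∧ ⌊ cornerFree? φ ⌋

  good⇒ : ∀ φ → T (good φ) → IsInvolution φ × CornerFree φ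
  good⇒ φ t with Equivalence.to T-∧ t
  ... | inv , free = Equivalence.to (T-isInvolution φ) inv , toWitness {a? = cornerFree? φ} free

  #Bad : ℕ
  #Bad = ∑[ φ ← words n ] 𝟙 (isInvolution φ ∧ not ⌊ cornerFree? φ ⌋)

  #Bad≤ : #Bad ≤ ∑[ i ← allFin k ] ∑[ j ← allFin k ] #Inv[ ↑ i ↦ ↑ j ]
  #Bad≤ = begin
    #Bad
      ≤⟨ ∑-mono-≤ (words n) pointwise ⟩
    ∑[ φ ← words n ] ∑[ i ← allFin k ] ∑[ j ← allFin k ] ι φ * δ (lookup φ (↑ i)) (↑ j)
      ≡⟨ ∑-comm (words n) (allFin k) _ ⟩
    ∑[ i ← allFin k ] ∑[ φ ← words n ] ∑[ j ← allFin k ] ι φ * δ (lookup φ (↑ i)) (↑ j)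
      ≡⟨ ∑-cong (allFin k) (λ i → ∑-comm (words n) (allFin k) _) ⟩
    ∑[ i ← allFin k ] ∑[ j ← allFin k ] #Inv[ ↑ i ↦ ↑ j ] ∎
    where
    open ≤-Reasoning
    ≤-∑ᵏ : ∀ i (g : Fin k → ℕ) → g i ≤ ∑ (allFin k) g
    ≤-∑ᵏ = FinEnumeration.≤-∑ {xs = allFin k} (allFin-isEnumeration k)
    pointwise : ∀ φ → 𝟙 (isInvolution φ ∧ not ⌊ cornerFree? φ ⌋) ≤
                      ∑[ i ← allFin k ] ∑[ j ← allFin k ] ι φ * δ (lookup φ (↑ i)) (↑ j)
    pointwise φ with cornerFree? φ
    ... | yes _     = ≤-trans (≤-reflexive (cong 𝟙 (∧-zeroʳ (isInvolution φ)))) z≤n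
    ... | no ¬free with ¬∀⟶∃¬ k _ (λ i → k ≤? toℕ (lookup φ (↑ i))) ¬free
    ...   | i , φi≱k = begin
      𝟙 (isInvolution φ ∧ true)
        ≡⟨ cong 𝟙 (∧-identityʳ _) ⟩
      ι φ
        ≡⟨ *-identityʳ (ι φ) ⟨
      ι φ * 1
        ≡⟨ cong (ι φ *_) (trans (sym (δ-refl (lookup φ (↑ i)))) (cong (δ (lookup φ (↑ i))) (sym (↑-fromℕ< φi<k)))) ⟩
      ι φ * δ (lookup φ (↑ i)) (↑ j)
        ≤⟨ ≤-∑ᵏ j (λ j → ι φ * δ (lookup φ (↑ i)) (↑ j)) ⟩
      ∑[ j ← allFin k ] ι φ * δ (lookup φ (↑ i)) (↑ j)
        ≤⟨ ≤-∑ᵏ i (λ i → ∑[ j ← allFin k ] ι φ * δ (lookup φ (↑ i)) (↑ j)) ⟩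
      ∑[ i ← allFin k ] ∑[ j ← allFin k ] ι φ * δ (lookup φ (↑ i)) (↑ j) ∎
      where
      φi<k = ≰⇒> φi≱k
      j = Fin.fromℕ< φi<k

  #Bad-bound : ∀ {M} → M < n → 2 * M * (2 * M) ≤ n → M * #Bad ≤ k * (k * #Inv n)
  #Bad-bound {M} M<n 4M²≤n = begin
    M * #Bad
      ≤⟨ *-monoʳ-≤ M #Bad≤ ⟩
    M * (∑[ i ← allFin k ] ∑[ j ← allFin k ] #Inv[ ↑ i ↦ ↑ j ]) ≡⟨ ∑-*ˡ (allFin k) M _ ⟨
    ∑[ i ← allFin k ] M * (∑[ j ← allFin k ] #Inv[ ↑ i ↦ ↑ j ]) ≡⟨ ∑-cong (allFin k) (λ i → ∑-*ˡ (allFin k) M _) ⟨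
    ∑[ i ← allFin k ] ∑[ j ← allFin k ] M * #Inv[ ↑ i ↦ ↑ j ]
      ≤⟨ ∑-mono-≤ (allFin k) (λ i → ∑-mono-≤ (allFin k) (λ j → #Inv-bound M<n 4M²≤n (↑ i) (↑ j))) ⟩
    ∑[ i ← allFin k ] ∑[ j ← allFin k ] #Inv n
      ≡⟨ ∑-cong (allFin k) (λ i → ∑-allFin-const k (#Inv n)) ⟩
    ∑[ i ← allFin k ] k * #Inv n
      ≡⟨ ∑-allFin-const k _ ⟩
    k * (k * #Inv n) ∎
    where open ≤-Reasoning

  -- φ is its own inverse, so this is the position at which the letter ↑ i stands.
  position : Word n → Fin k → ℕ
  position φ i = toℕ (lookup φ (↑ i))

  #Ordered : List (Fin k) → ℕ
  #Ordered L = ∑[ φ ← words n ] 𝟙 (good φ ∧ increasing (position φ) L)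

  module _ (a b : Fin k) where

    private
      π = transpose (↑ a) (↑ b)
      open Conjugation {π = π} (transpose-involutive (↑ a) (↑ b))

    lookup-conj-↑ : ∀ φ → CornerFree φ → ∀ c → lookup (conj π φ) (↑ c) ≡ lookup φ (↑ (transpose a b c))
    lookup-conj-↑ φ free c = begin
      lookup (conj π φ) (↑ c)              ≡⟨ lookup-conj π φ (↑ c) ⟩
      π (lookup φ (π (↑ c)))               ≡⟨ cong (π ∘ lookup φ) (transpose-inject ↑ ↑-injective a b c) ⟩
      π (lookup φ (↑ (transpose a b c)))   ≡⟨ transpose-other (↑≢large a (free _)) (↑≢large b (free _)) ⟩
      lookup φ (↑ (transpose a b c))       ∎
      where open ≡-Reasoning

    conj-cornerFree : ∀ φ → CornerFree φ → CornerFree (conj π φ)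
    conj-cornerFree φ free c = subst (λ z → k ≤ toℕ z) (sym (lookup-conj-↑ φ free c)) (free _)

    good-conj : ∀ φ → good (conj π φ) ≡ good φ
    good-conj φ = cong₂ _∧_ (isInvolution-conj φ) (T-injective (mk⇔
      (λ t → fromWitness (subst CornerFree (conj-involutive φ) (conj-cornerFree (conj π φ) (to (conj π φ) t))))
      (λ t → fromWitness (conj-cornerFree φ (to φ t)))))
      where
      to : ∀ ψ → T ⌊ cornerFree? ψ ⌋ → CornerFree ψ
      to ψ = Equivalence.to (T-⌊⌋ (cornerFree? ψ))

    #Ordered-transpose : ∀ L → #Ordered (map (transpose a b) L) ≡ #Ordered L
    #Ordered-transpose L = begin
      ∑[ φ ← words n ] 𝟙 (good φ ∧ increasing (position φ) (map τ L))
        ≡⟨ ∑-conj _ ⟨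
      ∑[ φ ← words n ] 𝟙 (good (conj π φ) ∧ increasing (position (conj π φ)) (map τ L)) ≡⟨ ∑-cong (words n) pointwise ⟩
      #Ordered L ∎
      where
      open ≡-Reasoning
      τ = transpose a b
      on-good : ∀ φ → 𝟙 (good φ ∧ increasing (position (conj π φ)) (map τ L)) ≡ 𝟙 (good φ ∧ increasing (position φ) L)
      on-good φ with good φ in g
      ... | false = refl
      ... | true  = cong 𝟙 (increasing-map (position (conj π φ)) τ (position φ)
                      (λ c → cong toℕ (trans (lookup-conj-↑ φ free (τ c)) (cong (lookup φ ∘ ↑) (transpose-involutive a b c)))) L)
        where free = proj₂ (good⇒ φ (Equivalence.from T-≡ g))
      pointwise : ∀ φ → 𝟙 (good (conj π φ) ∧ increasing (position (conj π φ)) (map τ L)) ≡ 𝟙 (good φ ∧ increasing (position φ) L)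
      pointwise φ = trans (cong (λ g → 𝟙 (g ∧ increasing (position (conj π φ)) (map τ L))) (good-conj φ)) (on-good φ)

  #Ordered-swap : ∀ p x y q → Unique (y ∷ p ++ x ∷ q) → #Ordered (p ++ x ∷ y ∷ q) ≡ #Ordered (p ++ y ∷ x ∷ q)
  #Ordered-swap p x y q (y∉ ∷ u) = begin
    #Ordered (p ++ x ∷ y ∷ q)                        ≡⟨ #Ordered-transpose x y (p ++ x ∷ y ∷ q) ⟨
    #Ordered (map (transpose x y) (p ++ x ∷ y ∷ q))  ≡⟨ cong #Ordered moved ⟩
    #Ordered (p ++ y ∷ x ∷ q)                        ∎
    where
    open ≡-Reasoning
    y∉p×x∷q = ++⁻ p y∉
    x∉p×q = ++⁻ p (unique-middle p u)
    moved : map (transpose x y) (p ++ x ∷ y ∷ q) ≡ p ++ y ∷ x ∷ q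
    moved = trans (List.map-++ (transpose x y) p (x ∷ y ∷ q)) (cong₂ _++_
      (map-transpose-id (proj₁ x∉p×q) (proj₁ y∉p×x∷q))
      (cong₂ _∷_ (transpose-matchˡ x y) (cong₂ _∷_ (transpose-matchʳ x y)
        (map-transpose-id (proj₂ x∉p×q) (All.tail (proj₂ y∉p×x∷q))))))

  #Ordered-insertAt : ∀ p s i y → Unique (y ∷ p ++ s) → #Ordered (p ++ insertAt s i y) ≡ #Ordered (p ++ y ∷ s)
  #Ordered-insertAt p s       Fin.zero    y _ = refl
  #Ordered-insertAt p (x ∷ s) (Fin.suc i) y u = begin
    #Ordered (p ++ x ∷ insertAt s i y)
      ≡⟨ cong #Ordered (List.++-assoc p (x ∷ []) _) ⟨
    #Ordered ((p ++ x ∷ []) ++ insertAt s i y)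
      ≡⟨ #Ordered-insertAt (p ++ x ∷ []) s i y (subst (λ l → Unique (y ∷ l)) (sym (List.++-assoc p (x ∷ []) s)) u) ⟩
    #Ordered ((p ++ x ∷ []) ++ y ∷ s)
      ≡⟨ cong #Ordered (List.++-assoc p (x ∷ []) _) ⟩
    #Ordered (p ++ x ∷ y ∷ s)
      ≡⟨ #Ordered-swap p x y s u ⟩
    #Ordered (p ++ y ∷ x ∷ s) ∎
    where open ≡-Reasoning

  #Ordered-cons : ∀ y s → Unique (y ∷ s) → #Ordered (y ∷ s) * suc (length s) ≡ #Ordered s
  #Ordered-cons y s u@(y∉s ∷ _) = begin
    #Ordered (y ∷ s) * suc (length s)     ≡⟨ *-comm (#Ordered (y ∷ s)) _ ⟩
    suc (length s) * #Ordered (y ∷ s)     ≡⟨ ∑-allFin-const (suc (length s)) _ ⟨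
    ∑[ i ← I ] #Ordered (y ∷ s)           ≡⟨ ∑-cong I (λ i → #Ordered-insertAt [] s i y u) ⟨
    ∑[ i ← I ] #Ordered (insertAt s i y)  ≡⟨ ∑-comm (words n) I _ ⟨
    ∑[ φ ← words n ] ∑[ i ← I ] 𝟙 (good φ ∧ increasing (position φ) (insertAt s i y))
                                          ≡⟨ ∑-cong (words n) exactly-one-slot ⟩
    #Ordered s                            ∎
    where
    open ≡-Reasoning
    I = allFin (suc (length s))
    exactly-one-slot : ∀ φ → ∑[ i ← I ] 𝟙 (good φ ∧ increasing (position φ) (insertAt s i y)) ≡
                             𝟙 (good φ ∧ increasing (position φ) s)
    exactly-one-slot φ with good φ in g
    ... | false = ∑-zero I
    ... | true  = ∑-increasing-insertAt (position φ) position-injective s y y∉s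
      where
      inv = proj₁ (good⇒ φ (Equivalence.from T-≡ g))
      position-injective : ∀ {i j} → position φ i ≡ position φ j → i ≡ j
      position-injective = ↑-injective ∘ involution-injective φ inv ∘ Fin.toℕ-injective

  #Ordered-unique : ∀ L → Unique L → #Ordered L * length L ! ≡ #Ordered []
  #Ordered-unique []      _            = *-identityʳ (#Ordered [])
  #Ordered-unique (y ∷ s) u@(_ ∷ s-unique) = begin
    #Ordered (y ∷ s) * (suc (length s) * length s !)  ≡⟨ *-assoc (#Ordered (y ∷ s)) _ _ ⟨
    #Ordered (y ∷ s) * suc (length s) * length s !    ≡⟨ cong (_* length s !) (#Ordered-cons y s u) ⟩
    #Ordered s * length s !                           ≡⟨ #Ordered-unique s s-unique ⟩
    #Ordered []                                       ∎
    where open ≡-Reasoning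

  containsSubseq≡increasing : ∀ (σ : Permutation′ k) φ → IsInvolution φ →
                              containsSubseq σ φ ≡ increasing (position φ) (tabulate (σ ⟨$⟩ʳ_))
  containsSubseq≡increasing σ φ inv = T-injective (mk⇔
    (λ t → Equivalence.from (increasing-tabulate (position φ) (σ ⟨$⟩ʳ_)) (sound t))
    (λ mono → complete (Equivalence.to (increasing-tabulate (position φ) (σ ⟨$⟩ʳ_)) mono)))
    where
    σ↑ : Fin k → Fin n
    σ↑ i = ↑ (σ ⟨$⟩ʳ i)
    at : ∀ {m} {p : Fin m → Bool} → T (all p (allFin m)) → ∀ i → T (p i)
    at = Equivalence.to (T-all-allFin _)
    every : ∀ {m} {p : Fin m → Bool} → (∀ i → T (p i)) → T (all p (allFin m))
    every = Equivalence.from (T-all-allFin _)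
    letter-at-position : ∀ i → toℕ (lookup φ (lookup φ (σ↑ i))) ≡ toℕ (σ ⟨$⟩ʳ i)
    letter-at-position i = trans (cong toℕ (inv (σ↑ i))) (toℕ-↑ _)
    position-of-letter : ∀ p i → toℕ (lookup φ p) ≡ toℕ (σ ⟨$⟩ʳ i) → lookup φ (σ↑ i) ≡ p
    position-of-letter p i φp≗σi =
      trans (cong (lookup φ) (sym (Fin.toℕ-injective (trans φp≗σi (sym (toℕ-↑ _)))))) (inv p)
    sound : T (containsSubseq σ φ) → ∀ {i j} → i Fin.< j → position φ (σ ⟨$⟩ʳ i) < position φ (σ ⟨$⟩ʳ j)
    sound t {i} {j} i<j = Equivalence.to (T-⌊⌋ (lookup φ (σ↑ i) Fin.<? lookup φ (σ↑ j)))
      (Equivalence.to (T-⇒ _ _) (at (at (at (at t i) j) (lookup φ (σ↑ i))) (lookup φ (σ↑ j)))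
        (Equivalence.from T-∧ (Equivalence.from (T-⌊⌋ (i Fin.<? j)) i<j ,
           Equivalence.from T-∧ (Equivalence.from (T-⌊⌋ (_ ≟ _)) (letter-at-position i) ,
                                 Equivalence.from (T-⌊⌋ (_ ≟ _)) (letter-at-position j)))))
    complete : (∀ {i j} → i Fin.< j → position φ (σ ⟨$⟩ʳ i) < position φ (σ ⟨$⟩ʳ j)) → T (containsSubseq σ φ)
    complete mono = every λ i → every λ j → every λ p → every λ q → Equivalence.from (T-⇒ _ _) λ c →
      let i<j , rest = Equivalence.to T-∧ c
          φp≗σi , φq≗σj = Equivalence.to T-∧ rest
      in fromWitness (subst₂ Fin._<_
           (position-of-letter p i (Equivalence.to (T-⌊⌋ (toℕ (lookup φ p) ≟ toℕ (σ ⟨$⟩ʳ i))) φp≗σi))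
           (position-of-letter q j (Equivalence.to (T-⌊⌋ (toℕ (lookup φ q) ≟ toℕ (σ ⟨$⟩ʳ j))) φq≗σj))
           (mono (Equivalence.to (T-⌊⌋ (i Fin.<? j)) i<j)))

  numInvolutions≡#Inv : numInvolutions n ≡ #Inv n
  numInvolutions≡#Inv = length-filter isInvolution (words n)

  #Inv≡#Ordered[]+#Bad : #Inv n ≡ #Ordered [] + #Bad
  #Inv≡#Ordered[]+#Bad = trans (∑-cong (words n) (λ φ → split (isInvolution φ) ⌊ cornerFree? φ ⌋)) (∑-distrib-+ (words n) _ _)
    where
    split : ∀ a c → 𝟙 a ≡ 𝟙 ((a ∧ c) ∧ true) + 𝟙 (a ∧ not c)
    split false c     = refl
    split true  true  = refl
    split true  false = refl

  #Bad-rare : ∀ {m} → 1 ≤ k → let M = 2 * (k * k) * suc m in M < n → 2 * M * (2 * M) ≤ n →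
              2 * suc m * #Bad ≤ #Inv n
  #Bad-rare {m} 1≤k M<n 4M²≤n = *-cancelˡ-≤ (k * k) {{>-nonZero (*-mono-≤ 1≤k 1≤k)}}
    (subst₂ _≤_ (regroup k m #Bad) (sym (*-assoc k k (#Inv n))) (#Bad-bound M<n 4M²≤n))
    where
    regroup : ∀ k m B → 2 * (k * k) * suc m * B ≡ k * k * (2 * suc m * B)
    regroup = solve-∀

  module _ (σ : Permutation′ k) where

    private
      L = tabulate (σ ⟨$⟩ʳ_)

    numContaining≡ : numContaining σ n ≡ ∑[ φ ← words n ] 𝟙 (isInvolution φ ∧ increasing (position φ) L)
    numContaining≡ = begin
      numContaining σ n
        ≡⟨ length-filter (containsSubseq σ) (involutions n) ⟩
      ∑[ φ ← involutions n ] 𝟙 (containsSubseq σ φ)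
        ≡⟨ ∑-filter isInvolution (words n) _ ⟩
      ∑[ φ ← words n ] 𝟙 (isInvolution φ) * 𝟙 (containsSubseq σ φ)
        ≡⟨ ∑-cong (words n) (λ φ → 𝟙-∧ (isInvolution φ) _) ⟨
      ∑[ φ ← words n ] 𝟙 (isInvolution φ ∧ containsSubseq σ φ)
        ≡⟨ ∑-cong (words n) (cong 𝟙 ∘ on-involutions) ⟩
      ∑[ φ ← words n ] 𝟙 (isInvolution φ ∧ increasing (position φ) L) ∎
      where
      open ≡-Reasoning
      on-involutions : ∀ φ → isInvolution φ ∧ containsSubseq σ φ ≡ isInvolution φ ∧ increasing (position φ) L
      on-involutions φ with isInvolution φ in inv
      ... | false = refl
      ... | true  = containsSubseq≡increasing σ φ (Equivalence.to (T-isInvolution φ) (Equivalence.from T-≡ inv))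

    #Ordered≤numContaining≤ : #Ordered L ≤ numContaining σ n × numContaining σ n ≤ #Ordered L + #Bad
    #Ordered≤numContaining≤ rewrite numContaining≡ =
        ∑-mono-≤ (words n) (λ φ → proj₁ (sandwich (isInvolution φ) ⌊ cornerFree? φ ⌋ (increasing (position φ) L)))
      , ≤-trans (∑-mono-≤ (words n) (λ φ → proj₂ (sandwich (isInvolution φ) ⌊ cornerFree? φ ⌋ (increasing (position φ) L))))
                (≤-reflexive (∑-distrib-+ (words n) _ _))
      where
      sandwich : ∀ a c l → 𝟙 ((a ∧ c) ∧ l) ≤ 𝟙 (a ∧ l) × 𝟙 (a ∧ l) ≤ 𝟙 ((a ∧ c) ∧ l) + 𝟙 (a ∧ not c)
      sandwich false c     l = z≤n , z≤n
      sandwich true  true  l = ≤-refl , m≤m+n (𝟙 l) 0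
      sandwich true  false l = z≤n , 𝟙≤1 l

    numContaining-deviation : ∣ + (numContaining σ n * k !) - + #Inv n ∣ ≤ #Bad * k !
    numContaining-deviation = distance-≤ above below
      where
      A = numContaining σ n
      O = #Ordered L
      lower = proj₁ #Ordered≤numContaining≤
      upper = proj₂ #Ordered≤numContaining≤
      σ-injective : ∀ {i j} → σ ⟨$⟩ʳ i ≡ σ ⟨$⟩ʳ j → i ≡ j
      σ-injective σi≡σj = trans (sym (inverseˡ σ)) (trans (cong (σ ⟨$⟩ˡ_) σi≡σj) (inverseˡ σ))
      O*k!≡ : O * k ! ≡ #Ordered []
      O*k!≡ = trans (cong (λ l → O * l !) (sym (List.length-tabulate (σ ⟨$⟩ʳ_))))
                    (#Ordered-unique L (Unique.tabulate⁺ σ-injective))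
      I≡ : #Inv n ≡ O * k ! + #Bad
      I≡ = trans #Inv≡#Ordered[]+#Bad (cong (_+ #Bad) (sym O*k!≡))
      above : A * k ! ≤ #Inv n + #Bad * k !
      above = begin
        A * k !
          ≤⟨ *-monoˡ-≤ (k !) upper ⟩
        (O + #Bad) * k !
          ≡⟨ *-distribʳ-+ (k !) O #Bad ⟩
        O * k ! + #Bad * k !
          ≤⟨ +-monoˡ-≤ (#Bad * k !) (≤-trans (m≤m+n (O * k !) #Bad) (≤-reflexive (sym I≡))) ⟩
        #Inv n + #Bad * k ! ∎
        where open ≤-Reasoning
      below : #Inv n ≤ A * k ! + #Bad * k !
      below = begin
        #Inv n
          ≡⟨ I≡ ⟩
        O * k ! + #Bad
          ≤⟨ +-mono-≤ (*-monoˡ-≤ (k !) lower) (m≤m*n #Bad (k !) {{>-nonZero (1≤n! k)}}) ⟩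
        A * k ! + #Bad * k ! ∎
        where open ≤-Reasoning

    numContaining-close : ∀ {m} → 1 ≤ k → let M = 2 * (k * k) * suc m in suc (2 * M * (2 * M) + M) ≤ n →
      ∣ + (numContaining σ n * k !) - + numInvolutions n ∣ * suc m < numInvolutions n * k !
    numContaining-close {m} 1≤k N≤n rewrite numInvolutions≡#Inv =
      relative-error (#Inv-positive n) (1≤n! k) numContaining-deviation (#Bad-rare 1≤k M<n 4M²≤n)
      where
      M = 2 * (k * k) * suc m
      M<n : M < n
      M<n = ≤-trans (s≤s (m≤n+m M _)) N≤n
      4M²≤n : 2 * M * (2 * M) ≤ n
      4M²≤n = ≤-trans (≤-trans (m≤m+n _ M) (n≤1+n _)) N≤n

lemma1 : (k : ℕ) → 1 ≤ k → (σ : Permutation′ k) → (m : ℕ) →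
    ∃ λ N → (n : ℕ) → N ≤ n → k ≤ n →
      ∣ + (numContaining σ n * k !) - + numInvolutions n ∣ * suc m
        < numInvolutions n * k !
lemma1 k 1≤k σ m = suc (2 * M * (2 * M) + M) , λ n N≤n k≤n → Corner.numContaining-close k≤n σ 1≤k N≤n
  where
  M = 2 * (k * k) * suc m
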